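{- Let $p$ be an odd prime, $s\ge1$ and $k\ge1$ integers, and $0<\lambda<p^s$ an integer. Write $\lambda=p^r\lambda'$ with $0\le r<s$ and $p\nmid\lambda'$. Then $$\rho_{k,\lambda}(p^s)=\begin{cases}\Omega\big(k,p,s,\tfrac{r-1}{2}\big)\cdot(\rho_{k,0}(p)-1), & \text{if } r \text{ is odd};\\[2pt] \Omega\big(k,p,s,\tfrac{r-2}{2}\big)\cdot(\rho_{k,0}(p)-1)+p^{k\frac{r}{2}+(s-r-1)(k-1)}\cdot\rho_{k,\lambda'}(p), & \text{if } r \text{ is even}.\end{cases}$$
   Context: For positive integers $k,n$ and an integer $\mu$, $\rho_{k,\mu}(n)$ is the number of $(x_1,\dots,x_k)\in(\mathbb{Z}/n\mathbb{Z})^k$ with $x_1^2+\cdots+x_k^2\equiv\mu\pmod n$. For integers $k,p,s$ and an integer $N\ge-1$, $\Omega(k,p,s,N):=\sum_{i=0}^{N}p^{ki+(s-2i-1)(k-1)}$, the empty sum (for $N=-1$) being $0$. -}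

module Defs where

open import Data.Nat as ℕ using (ℕ; zero; suc; _+_; _*_; _∸_; _^_)
open import Data.Fin using (Fin; toℕ)
open import Data.Fin.Properties using (all?)
open import Data.Integer as ℤ using (ℤ; +_)
open import Data.Integer.Divisibility.Signed as ZDiv using (_∣?_)
open import Data.Vec.Functional using (Vector)
open import Relation.Nullary using (Dec; yes; no; does)
open import Data.Bool using (true; false)

-- Number of elements of a finite product decidable predicate: count of
-- functions  x : Fin k → Fin n  (i.e. elements of (Z/nZ)^k, with Fin n as
-- the canonical residues 0..n-1) satisfying a boolean test.
countVec : (k n : ℕ) → (Vector (Fin n) k → Data.Bool.Bool) → ℕ
countVec zero    n P = if' (P (λ ()))
  where
    if' : Data.Bool.Bool → ℕ
    if' true  = 1
    if' false = 0
countVec (suc k) n P = sumFin n (λ a → countVec k n (λ v → P (cons a v)))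
  where
    sumFin : (m : ℕ) → (Fin m → ℕ) → ℕ
    sumFin zero    f = 0
    sumFin (suc m) f = f Fin.zero + sumFin m (λ i → f (Fin.suc i))
      where import Data.Fin as Fin
    cons : Fin n → Vector (Fin n) k → Vector (Fin n) (suc k)
    cons a v Fin.zero    = a
    cons a v (Fin.suc i) = v i
      where import Data.Fin as Fin

sumSq : {k n : ℕ} → Vector (Fin n) k → ℕ
sumSq {zero}  v = 0
sumSq {suc k} v = toℕ (v Fin.zero) * toℕ (v Fin.zero) + sumSq {k} (λ i → v (Fin.suc i))
  where import Data.Fin as Fin

ρ : (k : ℕ) → (μ : ℤ) → (n : ℕ) → ℕ
ρ k μ n = countVec k n (λ x → does ((+ n) ∣? ((+ sumSq x) ℤ.- μ)))

-- Ω(k,p,s,N) = Σ_{i=0}^{N} p^{k i + (s-2i-1)(k-1)}.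
-- Here Ω k p s m takes m = N + 1 (the number of terms, m ≥ 0 ⇔ N ≥ -1).
-- Exponents use truncated subtraction; in every use below s - 2i - 1 ≥ 0.
Ω : (k p s m : ℕ) → ℕ
Ω k p s zero    = 0
Ω k p s (suc i) = Ω k p s i + p ^ (k * i + (s ∸ (2 * i) ∸ 1) * (k ∸ 1))

{-# OPTIONS --safe #-}
-- Split the solutions of x₁² + ⋯ + xₖ² ≡ λ (mod pˢ) into the primitive ones, with some xᵢ
-- prime to p, and the rest. For odd p, Hensel's lemma lifts each primitive solution modulo pʲ
-- to exactly pᵏ⁻¹ solutions modulo pʲ⁺¹, so there are p^((s-1)(k-1)) times as many as modulo p,
-- namely ρ_{k,λ}(p) if p ∤ λ and ρ_{k,0}(p) - 1 if p ∣ λ. For s ≥ 2 the solutions x = p y exist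
-- only when p² ∣ λ, and then there are pᵏ ρ_{k,λ/p²}(pˢ⁻²) of them. Induction on the valuation
-- r of λ, which drops by 2 at each step, accumulates these contributions into Ω.
module Submission where

open import Defs
import Data.Nat.Properties as ℕ
open import Algebra.Properties.CommutativeSemigroup ℕ.+-commutativeSemigroup
  using () renaming (interchange to +-interchange)
open import Data.Bool using (Bool; true; false; if_then_else_)
open import Data.Fin using (Fin; toℕ)
import Data.Fin as Fin
open import Data.Integer as ℤ using (ℤ; +_; -_)
import Data.Integer.Properties as ℤ
open import Data.Integer.Divisibility.Signed as ℤ∣
  using (divides; _∣?_) renaming (_∣_ to _∣ᶻ_)
open import Data.Integer.DivMod using (_%ℕ_; _/ℕ_; a≡a%ℕn+[a/ℕn]*n; n%ℕd<d)
import Data.Integer.Tactic.RingSolver as ℤ-Ring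
open import Data.Nat
  using (ℕ; zero; suc; _+_; _*_; _^_; _∸_; _<_; _≤_; s≤s; z≤n; NonZero; >-nonZero⁻¹; nonTrivial⇒n>1)
import Data.Nat.Divisibility as ℕ
open import Data.Nat.Divisibility using (_∣_)
import Data.Nat.Tactic.RingSolver as ℕ-Ring
open import Data.Nat.Coprimality using (Coprime; coprime-Bézout)
import Data.Nat.GCD as GCD
open import Data.Nat.Primality using (Prime; euclidsLemma; prime⇒nonZero; prime⇒nonTrivial; prime⇒irreducible)
open import Data.Product using (∃-syntax; _×_; _,_)
open import Data.Sum using (inj₁; inj₂; [_,_]′)
open import Function using (_∘_; flip; _⇔_; mk⇔)
open import Relation.Binary.PropositionalEquality
open import Relation.Nullary using (¬_; does; yes; no)
open import Relation.Nullary.Decidable using (dec-true; dec-false; does-⇔; toSum)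
open import Relation.Nullary.Negation using (contradiction)

open ≡-Reasoning

-- Sums over initial segments of ℕ

∑< : ℕ → (ℕ → ℕ) → ℕ
∑< zero    f = 0
∑< (suc n) f = f 0 + ∑< n (f ∘ suc)

syntax ∑< n (λ x → e) = ∑[ x < n ] e

∑-cong : ∀ n {f g : ℕ → ℕ} → (∀ x → f x ≡ g x) → ∑< n f ≡ ∑< n g
∑-cong zero    f≗g = refl
∑-cong (suc n) f≗g = cong₂ _+_ (f≗g 0) (∑-cong n (f≗g ∘ suc))

∑-cong< : ∀ n {f g : ℕ → ℕ} → (∀ x → x < n → f x ≡ g x) → ∑< n f ≡ ∑< n g
∑-cong< zero    f≗g = refl
∑-cong< (suc n) f≗g = cong₂ _+_ (f≗g 0 (s≤s z≤n)) (∑-cong< n (λ x x<n → f≗g (suc x) (s≤s x<n)))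

∑-const : ∀ n c → ∑[ _ < n ] c ≡ n * c
∑-const zero    c = refl
∑-const (suc n) c = cong (_+_ c) (∑-const n c)

∑-vanish : ∀ n {f : ℕ → ℕ} → (∀ x → x < n → f x ≡ 0) → ∑< n f ≡ 0
∑-vanish n f≗0 = trans (∑-cong< n f≗0) (trans (∑-const n 0) (ℕ.*-zeroʳ n))

∑-distrib-+ : ∀ n (f g : ℕ → ℕ) → ∑[ x < n ] (f x + g x) ≡ ∑< n f + ∑< n g
∑-distrib-+ zero    f g = refl
∑-distrib-+ (suc n) f g = begin
  (f 0 + g 0) + ∑[ x < n ] (f (suc x) + g (suc x))   ≡⟨ cong (_+_ (f 0 + g 0)) (∑-distrib-+ n (f ∘ suc) (g ∘ suc)) ⟩
  (f 0 + g 0) + (∑< n (f ∘ suc) + ∑< n (g ∘ suc))    ≡⟨ +-interchange (f 0) (g 0) _ _ ⟩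
  (f 0 + ∑< n (f ∘ suc)) + (g 0 + ∑< n (g ∘ suc))    ∎

∑-distribˡ-* : ∀ n c (f : ℕ → ℕ) → ∑[ x < n ] (c * f x) ≡ c * ∑< n f
∑-distribˡ-* zero    c f = sym (ℕ.*-zeroʳ c)
∑-distribˡ-* (suc n) c f =
  trans (cong (_+_ (c * f 0)) (∑-distribˡ-* n c (f ∘ suc))) (sym (ℕ.*-distribˡ-+ c (f 0) _))

∑-comm : ∀ m n (h : ℕ → ℕ → ℕ) → ∑[ x < m ] ∑[ y < n ] h x y ≡ ∑[ y < n ] ∑[ x < m ] h x y
∑-comm zero    n h = sym (∑-vanish n (λ _ _ → refl))
∑-comm (suc m) n h = trans (cong (_+_ (∑< n (h 0))) (∑-comm m n (h ∘ suc)))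
                           (sym (∑-distrib-+ n (h 0) (λ y → ∑[ x < m ] h (suc x) y)))

∑-++ : ∀ m n (f : ℕ → ℕ) → ∑< (m + n) f ≡ ∑< m f + ∑[ x < n ] f (m + x)
∑-++ zero    n f = refl
∑-++ (suc m) n f = trans (cong (_+_ (f 0)) (∑-++ m n (f ∘ suc))) (sym (ℕ.+-assoc (f 0) _ _))

∑-blocks : ∀ m n (f : ℕ → ℕ) → ∑< (m * n) f ≡ ∑[ z < m ] ∑[ y < n ] f (z * n + y)
∑-blocks zero    n f = refl
∑-blocks (suc m) n f = begin
  ∑< (n + m * n) f                                   ≡⟨ ∑-++ n (m * n) f ⟩
  ∑< n f + ∑[ x < m * n ] f (n + x)                  ≡⟨ cong (_+_ (∑< n f)) (∑-blocks m n (f ∘ _+_ n)) ⟩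
  ∑< n f + ∑[ z < m ] ∑[ y < n ] f (n + (z * n + y)) ≡⟨ cong (_+_ (∑< n f)) (∑-cong m (λ z → ∑-cong n (λ y →
                                                          cong f (sym (ℕ.+-assoc n (z * n) y))))) ⟩
  ∑< n f + ∑[ z < m ] ∑[ y < n ] f (n + z * n + y)   ∎

∑-periodic : ∀ m n (f : ℕ → ℕ) → (∀ z y → f (z * n + y) ≡ f y) → ∑< (m * n) f ≡ m * ∑< n f
∑-periodic m n f periodic = begin
  ∑< (m * n) f                       ≡⟨ ∑-blocks m n f ⟩
  ∑[ z < m ] ∑[ y < n ] f (z * n + y) ≡⟨ ∑-cong m (λ z → ∑-cong n (periodic z)) ⟩
  ∑[ _ < m ] ∑< n f                   ≡⟨ ∑-const m _ ⟩
  m * ∑< n f                         ∎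

∑-single : ∀ n (f : ℕ → ℕ) u → u < n → (∀ x → x < n → x ≢ u → f x ≡ 0) → ∑< n f ≡ f u
∑-single (suc n) f zero    _         off = trans (cong (_+_ (f 0)) (∑-vanish n (λ x x<n →
  off (suc x) (s≤s x<n) λ ()))) (ℕ.+-identityʳ (f 0))
∑-single (suc n) f (suc u) (s≤s u<n) off = trans (cong (_+ ∑< n (f ∘ suc)) (off 0 (s≤s z≤n) λ ()))
  (∑-single n (f ∘ suc) u u<n (λ x x<n x≢u → off (suc x) (s≤s x<n) (x≢u ∘ ℕ.suc-injective)))

-- Counting solutions of a quadratic congruence

infix 4 _≡_mod_
record _≡_mod_ (c c′ : ℤ) (L : ℕ) : Set where
  constructor mod-by
  field L∣c-c′ : + L ∣ᶻ c ℤ.- c′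

≡-mod-+ʳ : ∀ {L c c′} t → c ≡ c′ mod L → c ℤ.+ t ≡ c′ ℤ.+ t mod L
≡-mod-+ʳ {c = c} {c′} t (mod-by L∣c-c′) = mod-by (subst (_ ∣ᶻ_) (shift c c′ t) L∣c-c′)
  where
  shift : ∀ c c′ t → c ℤ.- c′ ≡ (c ℤ.+ t) ℤ.- (c′ ℤ.+ t)
  shift = ℤ-Ring.solve-∀

𝟙[_∣_] : ℕ → ℤ → ℕ
𝟙[ L ∣ c ] = if does (+ L ∣? c) then 1 else 0

𝟙-yes : ∀ {L c} → + L ∣ᶻ c → 𝟙[ L ∣ c ] ≡ 1
𝟙-yes L∣c = cong (if_then 1 else 0) (dec-true (_ ∣? _) L∣c)

𝟙-no : ∀ {L c} → ¬ (+ L ∣ᶻ c) → 𝟙[ L ∣ c ] ≡ 0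
𝟙-no L∤c = cong (if_then 1 else 0) (dec-false (_ ∣? _) L∤c)

𝟙-cong : ∀ {L L′ c c′} → (+ L ∣ᶻ c ⇔ + L′ ∣ᶻ c′) → 𝟙[ L ∣ c ] ≡ 𝟙[ L′ ∣ c′ ]
𝟙-cong L∣c⇔L′∣c′ = cong (if_then 1 else 0) (does-⇔ L∣c⇔L′∣c′ (_ ∣? _) (_ ∣? _))

𝟙-mod : ∀ {L c c′} → c ≡ c′ mod L → 𝟙[ L ∣ c ] ≡ 𝟙[ L ∣ c′ ]
𝟙-mod {c = c} {c′} (mod-by L∣c-c′) = 𝟙-cong (mk⇔
  (λ L∣c → subst (_ ∣ᶻ_) (c-[c-c′] c c′) (ℤ∣.∣m∣n⇒∣m-n L∣c L∣c-c′))
  (λ L∣c′ → subst (_ ∣ᶻ_) ([c-c′]+c′ c c′) (ℤ∣.∣m∣n⇒∣m+n L∣c-c′ L∣c′)))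
  where
  c-[c-c′] : ∀ c c′ → c ℤ.- (c ℤ.- c′) ≡ c′
  c-[c-c′] = ℤ-Ring.solve-∀
  [c-c′]+c′ : ∀ c c′ → (c ℤ.- c′) ℤ.+ c′ ≡ c
  [c-c′]+c′ = ℤ-Ring.solve-∀

infix 8 _·²_
_·²_ : ℕ → ℕ → ℤ
a ·² x = + (a * (x * x))

-- sqCount k a R L c counts the x ∈ [0, R)ᵏ with L ∣ c + a (x₁² + ⋯ + xₖ²).
sqCount : (k a R L : ℕ) → ℤ → ℕ
sqCount zero    a R L c = 𝟙[ L ∣ c ]
sqCount (suc k) a R L c = ∑[ x < R ] sqCount k a R L (c ℤ.+ a ·² x)

countSumSq : ℕ → ℕ → (ℕ → Bool) → ℕ
countSumSq zero    n P = if P 0 then 1 else 0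
countSumSq (suc k) n P = ∑[ x < n ] countSumSq k n (λ q → P (x * x + q))

countSumSq-cong : ∀ k n {P Q : ℕ → Bool} → (∀ q → P q ≡ Q q) → countSumSq k n P ≡ countSumSq k n Q
countSumSq-cong zero    n P≗Q = cong (if_then 1 else 0) (P≗Q 0)
countSumSq-cong (suc k) n P≗Q = ∑-cong n (λ x → countSumSq-cong k n (λ q → P≗Q (x * x + q)))

∑ᶠ : (m : ℕ) → (Fin m → ℕ) → ℕ
∑ᶠ zero    f = 0
∑ᶠ (suc m) f = f Fin.zero + ∑ᶠ m (f ∘ Fin.suc)

∑ᶠ-unique : (h : (m : ℕ) → (Fin m → ℕ) → ℕ) →
            (∀ f → h zero f ≡ 0) → (∀ m f → h (suc m) f ≡ f Fin.zero + h m (f ∘ Fin.suc)) →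
            ∀ m f → h m f ≡ ∑ᶠ m f
∑ᶠ-unique h h0 hs zero    f = h0 f
∑ᶠ-unique h h0 hs (suc m) f = trans (hs m f) (cong (_+_ (f Fin.zero)) (∑ᶠ-unique h h0 hs m (f ∘ Fin.suc)))

∑ᶠ-toℕ : ∀ m g → ∑ᶠ m (g ∘ toℕ) ≡ ∑< m g
∑ᶠ-toℕ zero    g = refl
∑ᶠ-toℕ (suc m) g = cong (_+_ (g 0)) (∑ᶠ-toℕ m (g ∘ suc))

-- countVec sums over the first coordinate with a helper local to Defs, which cannot be named;
-- once the length and the summand are with-abstracted, that helper solves the metavariable h.
countVec-suc : ∀ k n (P : ℕ → Bool) → countVec (suc k) n (λ v → P (sumSq v))
             ≡ ∑ᶠ n (λ x → countVec k n (λ v → P (toℕ x * toℕ x + sumSq v)))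
countVec-suc k zero    P = refl
countVec-suc k (suc n) P
  with ∑ᶠ-unique _ (λ _ → refl) (λ _ _ → refl) | n
     | (λ (x : Fin n) → countVec k (suc n) (λ v → P (suc (toℕ x) * suc (toℕ x) + sumSq v)))
... | helper≡∑ᶠ | m | f = cong (_+_ (countVec k (suc m) (λ v → P (sumSq v)))) (helper≡∑ᶠ m f)

countVec-sumSq : ∀ k n (P : ℕ → Bool) → countVec k n (λ v → P (sumSq v)) ≡ countSumSq k n P
countVec-sumSq zero    n P with P 0
... | true  = refl
... | false = refl
countVec-sumSq (suc k) n P = begin
  countVec (suc k) n (λ v → P (sumSq v))                       ≡⟨ countVec-suc k n P ⟩
  ∑ᶠ n (λ x → countVec k n (λ v → P (toℕ x * toℕ x + sumSq v))) ≡⟨ ∑ᶠ-toℕ n _ ⟩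
  ∑[ x < n ] countVec k n (λ v → P (x * x + sumSq v))          ≡⟨ ∑-cong n (λ x → countVec-sumSq k n _) ⟩
  countSumSq (suc k) n P                                       ∎

countSumSq-∣ : ∀ k n L c → countSumSq k n (λ q → does (+ L ∣? (+ q ℤ.+ c))) ≡ sqCount k 1 n L c
countSumSq-∣ zero    n L c = cong 𝟙[ L ∣_] (ℤ.+-identityˡ c)
countSumSq-∣ (suc k) n L c = ∑-cong n λ x →
  trans (countSumSq-cong k n (λ q → cong (does ∘ (+ L ∣?_)) (reassoc x q)))
        (countSumSq-∣ k n L (c ℤ.+ 1 ·² x))
  where
  reassoc : ∀ x q → + (x * x + q) ℤ.+ c ≡ + q ℤ.+ (c ℤ.+ 1 ·² x)
  reassoc x q = begin
    + (x * x + q) ℤ.+ c                  ≡⟨ cong (ℤ._+ c) (ℤ.pos-+ (x * x) q) ⟩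
    (+ (x * x) ℤ.+ + q) ℤ.+ c            ≡⟨ rotate (+ (x * x)) (+ q) c ⟩
    + q ℤ.+ (c ℤ.+ + (x * x))            ≡⟨ cong (λ t → + q ℤ.+ (c ℤ.+ + t)) (sym (ℕ.*-identityˡ (x * x))) ⟩
    + q ℤ.+ (c ℤ.+ 1 ·² x)               ∎
    where
    rotate : ∀ a b c → (a ℤ.+ b) ℤ.+ c ≡ b ℤ.+ (c ℤ.+ a)
    rotate = ℤ-Ring.solve-∀

ρ≡sqCount : ∀ k μ n → ρ k μ n ≡ sqCount k 1 n n (- μ)
ρ≡sqCount k μ n = trans (countVec-sumSq k n _) (countSumSq-∣ k n n (- μ))

≡-mod-+ˡ : ∀ {L t t′} c → t ≡ t′ mod L → c ℤ.+ t ≡ c ℤ.+ t′ mod L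
≡-mod-+ˡ {t = t} {t′} c (mod-by L∣t-t′) = mod-by (subst (_ ∣ᶻ_) (cancel c t t′) L∣t-t′)
  where
  cancel : ∀ c t t′ → t ℤ.- t′ ≡ (c ℤ.+ t) ℤ.- (c ℤ.+ t′)
  cancel = ℤ-Ring.solve-∀

ℕ-≡-mod : ∀ {L m n} q → m ≡ n + q * L → + m ≡ + n mod L
ℕ-≡-mod {L} {m} {n} q refl = mod-by (divides (+ q) (begin
  + (n + q * L) ℤ.- + n            ≡⟨ cong (ℤ._- + n) (ℤ.pos-+ n (q * L)) ⟩
  (+ n ℤ.+ + (q * L)) ℤ.- + n      ≡⟨ +-cancelˡ (+ n) (+ (q * L)) ⟩
  + (q * L)                        ≡⟨ ℤ.pos-* q L ⟩
  + q ℤ.* + L                      ∎))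
  where
  +-cancelˡ : ∀ a b → (a ℤ.+ b) ℤ.- a ≡ b
  +-cancelˡ = ℤ-Ring.solve-∀

square-periodic : ∀ a L z y → a ·² (z * L + y) ≡ a ·² y mod L
square-periodic a L z y = ℕ-≡-mod (a * (z * z * L + 2 * z * y)) (expand a L z y)
  where
  expand : ∀ a L z y → a * ((z * L + y) * (z * L + y)) ≡ a * (y * y) + a * (z * z * L + 2 * z * y) * L
  expand = ℕ-Ring.solve-∀

sqCount-mod : ∀ k {a R L c c′} → c ≡ c′ mod L → sqCount k a R L c ≡ sqCount k a R L c′
sqCount-mod zero    c≡c′ = 𝟙-mod c≡c′
sqCount-mod (suc k) {a} {R} c≡c′ = ∑-cong R (λ x → sqCount-mod k (≡-mod-+ʳ (a ·² x) c≡c′))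

∑-sqCount-periodic : ∀ k a R L m c →
  ∑[ x < m * L ] sqCount k a R L (c ℤ.+ a ·² x) ≡ m * ∑[ x < L ] sqCount k a R L (c ℤ.+ a ·² x)
∑-sqCount-periodic k a R L m c =
  ∑-periodic m L _ (λ z y → sqCount-mod k (≡-mod-+ˡ c (square-periodic a L z y)))

^-*-suc : ∀ m k x → m ^ k * (m * x) ≡ m ^ suc k * x
^-*-suc m k x = trans (sym (ℕ.*-assoc (m ^ k) m x)) (cong (_* x) (ℕ.*-comm (m ^ k) m))

sqCount-range : ∀ k a L m c → sqCount k a (m * L) L c ≡ m ^ k * sqCount k a L L c
sqCount-range zero    a L m c = sym (ℕ.*-identityˡ _)
sqCount-range (suc k) a L m c = begin
  ∑[ x < m * L ] sqCount k a (m * L) L (c ℤ.+ a ·² x)      ≡⟨ ∑-cong (m * L) (λ x → sqCount-range k a L m _) ⟩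
  ∑[ x < m * L ] (m ^ k * sqCount k a L L (c ℤ.+ a ·² x))  ≡⟨ ∑-distribˡ-* (m * L) (m ^ k) _ ⟩
  m ^ k * ∑[ x < m * L ] sqCount k a L L (c ℤ.+ a ·² x)    ≡⟨ cong (m ^ k *_) (∑-sqCount-periodic k a L L m c) ⟩
  m ^ k * (m * sqCount (suc k) a L L c)                    ≡⟨ ^-*-suc m k _ ⟩
  m ^ suc k * sqCount (suc k) a L L c                      ∎

𝟙-scale : ∀ d .{{_ : NonZero d}} L c → 𝟙[ d * L ∣ + d ℤ.* c ] ≡ 𝟙[ L ∣ c ]
𝟙-scale d L c = 𝟙-cong {d * L} {L} {+ d ℤ.* c} {c} (mk⇔
  (λ dL∣dc → ℤ∣.*-cancelˡ-∣ (+ d) (subst (_∣ᶻ _) (ℤ.pos-* d L) dL∣dc))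
  (λ L∣c → subst (_∣ᶻ + d ℤ.* c) (sym (ℤ.pos-* d L)) (ℤ∣.*-monoʳ-∣ (+ d) L∣c)))

sqCount-scale : ∀ k d .{{_ : NonZero d}} a R L c →
  sqCount k (d * a) R (d * L) (+ d ℤ.* c) ≡ sqCount k a R L c
sqCount-scale zero    d a R L c = 𝟙-scale d L c
sqCount-scale (suc k) d a R L c = ∑-cong R λ x →
  trans (cong (sqCount k (d * a) R (d * L)) (scaled-shift x)) (sqCount-scale k d a R L (c ℤ.+ a ·² x))
  where
  scaled-shift : ∀ x → + d ℤ.* c ℤ.+ (d * a) ·² x ≡ + d ℤ.* (c ℤ.+ a ·² x)
  scaled-shift x = begin
    + d ℤ.* c ℤ.+ + (d * a * (x * x))        ≡⟨ cong (λ t → + d ℤ.* c ℤ.+ + t) (ℕ.*-assoc d a (x * x)) ⟩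
    + d ℤ.* c ℤ.+ + (d * (a * (x * x)))      ≡⟨ cong (ℤ._+_ (+ d ℤ.* c)) (ℤ.pos-* d (a * (x * x))) ⟩
    + d ℤ.* c ℤ.+ + d ℤ.* a ·² x             ≡⟨ ℤ.*-distribˡ-+ (+ d) c (a ·² x) ⟨
    + d ℤ.* (c ℤ.+ a ·² x)                   ∎

sqCount-vanish : ∀ k {D a R L c} → D ℕ.∣ a → D ℕ.∣ L → ¬ (+ D ∣ᶻ c) → sqCount k a R L c ≡ 0
sqCount-vanish zero    D∣a D∣L D∤c = 𝟙-no (D∤c ∘ ℤ∣.∣-trans (ℤ∣.∣ᵤ⇒∣ D∣L))
sqCount-vanish (suc k) {a = a} {R} D∣a D∣L D∤c = ∑-vanish R λ x _ →
  sqCount-vanish k D∣a D∣L (λ D∣c+ax² → D∤c (ℤ∣.∣m+n∣n⇒∣m D∣c+ax² (ℤ∣.∣ᵤ⇒∣ (ℕ.∣-trans D∣a (ℕ.m∣m*n (x * x))))))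

sqCount-range-1 : ∀ k a L c → sqCount k a 1 L c ≡ 𝟙[ L ∣ c ]
sqCount-range-1 zero    a L c = refl
sqCount-range-1 (suc k) a L c = begin
  sqCount k a 1 L (c ℤ.+ a ·² 0) + 0   ≡⟨ ℕ.+-identityʳ _ ⟩
  sqCount k a 1 L (c ℤ.+ a ·² 0)       ≡⟨ cong (λ t → sqCount k a 1 L (c ℤ.+ + t)) (ℕ.*-zeroʳ a) ⟩
  sqCount k a 1 L (c ℤ.+ + 0)          ≡⟨ cong (sqCount k a 1 L) (ℤ.+-identityʳ c) ⟩
  sqCount k a 1 L c                    ≡⟨ sqCount-range-1 k a L c ⟩
  𝟙[ L ∣ c ]                           ∎

-- Linear congruences modulo a prime

∣∧<⇒≡0 : ∀ {m n} → n ℕ.∣ m → m < n → m ≡ 0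
∣∧<⇒≡0 {zero}  _   _   = refl
∣∧<⇒≡0 {suc m} n∣m m<n = contradiction n∣m (ℕ.>⇒∤ m<n)

residue-unique : ∀ {n u u′} → + u ≡ + u′ mod n → u < n → u′ < n → u ≡ u′
residue-unique {n} {u} {u′} (mod-by n∣u-u′) u<n u′<n =
  ℤ.+-injective (ℤ.i-j≡0⇒i≡j (+ u) (+ u′) (ℤ.∣i∣≡0⇒i≡0 (∣∧<⇒≡0 (ℤ∣.∣⇒∣ᵤ n∣u-u′) distance<n)))
  where
  distance<n : ℤ.∣ + u ℤ.- + u′ ∣ < n
  distance<n = subst (_< n) (cong ℤ.∣_∣ (sym (ℤ.m-n≡m⊖n u u′)))
                     (ℕ.≤-<-trans (ℤ.∣m⊝n∣≤m⊔n u u′) (ℕ.⊔-lub u<n u′<n))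

module _ {p : ℕ} (p-prime : Prime p) where

  private instance
    p≢0 : NonZero p
    p≢0 = prime⇒nonZero p-prime

  ∤⇒coprime : ∀ {b} → ¬ p ℕ.∣ b → Coprime b p
  ∤⇒coprime p∤b (d∣b , d∣p) with prime⇒irreducible p-prime d∣p
  ... | inj₁ d≡1 = d≡1
  ... | inj₂ refl = contradiction d∣b p∤b

  prime-∣ᶻ-* : ∀ {b x} → ¬ p ℕ.∣ b → + p ∣ᶻ + b ℤ.* x → + p ∣ᶻ x
  prime-∣ᶻ-* {b} {x} p∤b p∣bx
    with euclidsLemma b ℤ.∣ x ∣ p-prime (subst (p ℕ.∣_) (ℤ.abs-* (+ b) x) (ℤ∣.∣⇒∣ᵤ p∣bx))
  ... | inj₁ p∣b = contradiction p∣b p∤b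
  ... | inj₂ p∣x = ℤ∣.∣ᵤ⇒∣ p∣x

  inverse-mod : ∀ {b} → ¬ p ℕ.∣ b → ∃[ w ] w ℤ.* + b ≡ + 1 mod p
  inverse-mod {b} p∤b with coprime-Bézout (∤⇒coprime p∤b)
  ... | GCD.Bézout.+- x y 1+yp≡xb =
    + x , subst (_≡ + 1 mod p) (ℤ.pos-* x b) (ℕ-≡-mod y (sym 1+yp≡xb))
  ... | GCD.Bézout.-+ x y 1+xb≡yp = - + x , mod-by (divides (- + y) (begin
    - + x ℤ.* + b ℤ.- + 1     ≡⟨ negate (+ x) (+ b) ⟩
    - (+ 1 ℤ.+ + x ℤ.* + b)   ≡⟨ cong (λ t → - (+ 1 ℤ.+ t)) (ℤ.pos-* x b) ⟨
    - + (1 + x * b)           ≡⟨ cong (-_ ∘ +_) 1+xb≡yp ⟩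
    - + (y * p)               ≡⟨ cong -_ (ℤ.pos-* y p) ⟩
    - (+ y ℤ.* + p)           ≡⟨ ℤ.neg-distribˡ-* (+ y) (+ p) ⟩
    - + y ℤ.* + p             ∎))
    where
    negate : ∀ x b → - x ℤ.* b ℤ.- + 1 ≡ - (+ 1 ℤ.+ x ℤ.* b)
    negate = ℤ-Ring.solve-∀

  linear-root : ∀ {b} → ¬ p ℕ.∣ b → ∀ e → ∃[ u ] u < p × + p ∣ᶻ e ℤ.+ + (b * u)
  linear-root {b} p∤b e with inverse-mod p∤b
  ... | w , mod-by (divides D wb-1≡Dp) = r , n%ℕd<d t p , divides (- (e ℤ.* D) ℤ.- + b ℤ.* q) (begin
    e ℤ.+ + (b * r)                                  ≡⟨ cong (ℤ._+_ e) (ℤ.pos-* b r) ⟩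
    e ℤ.+ + b ℤ.* + r                                ≡⟨ cong (λ z → e ℤ.+ + b ℤ.* z) r≡t-qp ⟩
    e ℤ.+ + b ℤ.* (- e ℤ.* w ℤ.- q ℤ.* + p)          ≡⟨ expand e (+ b) w q (+ p) ⟩
    - (e ℤ.* (w ℤ.* + b ℤ.- + 1)) ℤ.- + b ℤ.* q ℤ.* + p ≡⟨ cong (λ z → - (e ℤ.* z) ℤ.- + b ℤ.* q ℤ.* + p) wb-1≡Dp ⟩
    - (e ℤ.* (D ℤ.* + p)) ℤ.- + b ℤ.* q ℤ.* + p      ≡⟨ collect e D (+ b) q (+ p) ⟩
    (- (e ℤ.* D) ℤ.- + b ℤ.* q) ℤ.* + p              ∎)
    where
    t = - e ℤ.* w
    r = t %ℕ p
    q = t /ℕ p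
    r≡t-qp : + r ≡ t ℤ.- q ℤ.* + p
    r≡t-qp = trans (add-sub (+ r) (q ℤ.* + p)) (cong (ℤ._- q ℤ.* + p) (sym (a≡a%ℕn+[a/ℕn]*n t p)))
      where
      add-sub : ∀ r x → r ≡ (r ℤ.+ x) ℤ.- x
      add-sub = ℤ-Ring.solve-∀
    expand : ∀ e b w q p → e ℤ.+ b ℤ.* (- e ℤ.* w ℤ.- q ℤ.* p) ≡ - (e ℤ.* (w ℤ.* b ℤ.- + 1)) ℤ.- b ℤ.* q ℤ.* p
    expand = ℤ-Ring.solve-∀
    collect : ∀ e D b q p → - (e ℤ.* (D ℤ.* p)) ℤ.- b ℤ.* q ℤ.* p ≡ (- (e ℤ.* D) ℤ.- b ℤ.* q) ℤ.* p
    collect = ℤ-Ring.solve-∀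

  linear-root-unique : ∀ {b e u u′} → ¬ p ℕ.∣ b → u < p → u′ < p →
    + p ∣ᶻ e ℤ.+ + (b * u) → + p ∣ᶻ e ℤ.+ + (b * u′) → u ≡ u′
  linear-root-unique {b} {e} {u} {u′} p∤b u<p u′<p p∣e+bu p∣e+bu′ =
    residue-unique (mod-by (prime-∣ᶻ-* p∤b (subst (_ ∣ᶻ_) difference (ℤ∣.∣m∣n⇒∣m-n p∣e+bu p∣e+bu′)))) u<p u′<p
    where
    difference : (e ℤ.+ + (b * u)) ℤ.- (e ℤ.+ + (b * u′)) ≡ + b ℤ.* (+ u ℤ.- + u′)
    difference = trans (cong₂ (λ s t → (e ℤ.+ s) ℤ.- (e ℤ.+ t)) (ℤ.pos-* b u) (ℤ.pos-* b u′)) (factor e (+ b) (+ u) (+ u′))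
      where
      factor : ∀ e b u u′ → (e ℤ.+ b ℤ.* u) ℤ.- (e ℤ.+ b ℤ.* u′) ≡ b ℤ.* (u ℤ.- u′)
      factor = ℤ-Ring.solve-∀

  ∑-𝟙-linear : ∀ {b} → ¬ p ℕ.∣ b → ∀ e → ∑[ u < p ] 𝟙[ p ∣ e ℤ.+ + (b * u) ] ≡ 1
  ∑-𝟙-linear p∤b e = let u₀ , u₀<p , p∣root = linear-root p∤b e in trans
    (∑-single p _ u₀ u₀<p (λ u u<p u≢u₀ → 𝟙-no (u≢u₀ ∘ λ p∣e+bu → linear-root-unique {e = e} p∤b u<p u₀<p p∣e+bu p∣root)))
    (𝟙-yes p∣root)

  ∑-𝟙-lift : ∀ {b} → ¬ p ℕ.∣ b → ∀ n .{{_ : NonZero n}} d →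
    ∑[ u < p ] 𝟙[ p * n ∣ d ℤ.+ + (n * b * u) ] ≡ 𝟙[ n ∣ d ]
  ∑-𝟙-lift {b} p∤b n d = [ multiple , non-multiple ]′ (toSum (+ n ∣? d))
    where
    multiple : + n ∣ᶻ d → ∑[ u < p ] 𝟙[ p * n ∣ d ℤ.+ + (n * b * u) ] ≡ 𝟙[ n ∣ d ]
    multiple n∣d@(divides e d≡en) = begin
      ∑[ u < p ] 𝟙[ p * n ∣ d ℤ.+ + (n * b * u) ]      ≡⟨ ∑-cong p (λ u → cong₂ 𝟙[_∣_] (ℕ.*-comm p n) (factor u)) ⟩
      ∑[ u < p ] 𝟙[ n * p ∣ + n ℤ.* (e ℤ.+ + (b * u)) ] ≡⟨ ∑-cong p (λ u → 𝟙-scale n p _) ⟩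
      ∑[ u < p ] 𝟙[ p ∣ e ℤ.+ + (b * u) ]               ≡⟨ ∑-𝟙-linear p∤b e ⟩
      1                                                 ≡⟨ 𝟙-yes n∣d ⟨
      𝟙[ n ∣ d ]                                        ∎
      where
      distrib : ∀ e n t → e ℤ.* n ℤ.+ n ℤ.* t ≡ n ℤ.* (e ℤ.+ t)
      distrib = ℤ-Ring.solve-∀
      factor : ∀ u → d ℤ.+ + (n * b * u) ≡ + n ℤ.* (e ℤ.+ + (b * u))
      factor u = begin
        d ℤ.+ + (n * b * u)                 ≡⟨ cong₂ ℤ._+_ d≡en (cong +_ (ℕ.*-assoc n b u)) ⟩
        e ℤ.* + n ℤ.+ + (n * (b * u))       ≡⟨ cong (ℤ._+_ (e ℤ.* + n)) (ℤ.pos-* n (b * u)) ⟩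
        e ℤ.* + n ℤ.+ + n ℤ.* + (b * u)     ≡⟨ distrib e (+ n) (+ (b * u)) ⟩
        + n ℤ.* (e ℤ.+ + (b * u))           ∎
    non-multiple : ¬ (+ n ∣ᶻ d) → ∑[ u < p ] 𝟙[ p * n ∣ d ℤ.+ + (n * b * u) ] ≡ 𝟙[ n ∣ d ]
    non-multiple n∤d = trans (∑-vanish p λ u _ → 𝟙-no λ pn∣d+nbu →
        n∤d (ℤ∣.∣m+n∣n⇒∣m (ℤ∣.∣-trans (ℤ∣.∣ᵤ⇒∣ (ℕ.n∣m*n p)) pn∣d+nbu)
                          (ℤ∣.∣ᵤ⇒∣ (ℕ.∣-trans (ℕ.m∣m*n b) (ℕ.m∣m*n u)))))
      (sym (𝟙-no n∤d))

  -- The p shifts d + n b u (u < p) meet each residue modulo p n above d modulo n exactly once.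
  ∑-sqCount-lift : ∀ {b} → ¬ p ℕ.∣ b → ∀ k a n .{{_ : NonZero n}} d →
    ∑[ u < p ] sqCount k a (p * n) (p * n) (d ℤ.+ + (n * b * u)) ≡ p ^ k * sqCount k a n n d
  ∑-sqCount-lift p∤b zero    a n d = trans (∑-𝟙-lift p∤b n d) (sym (ℕ.*-identityˡ _))
  ∑-sqCount-lift {b} p∤b (suc k) a n d = begin
    ∑[ u < p ] ∑[ x < p * n ] sqCount k a (p * n) (p * n) ((d ℤ.+ + (n * b * u)) ℤ.+ a ·² x)
      ≡⟨ ∑-comm p (p * n) _ ⟩
    ∑[ x < p * n ] ∑[ u < p ] sqCount k a (p * n) (p * n) ((d ℤ.+ + (n * b * u)) ℤ.+ a ·² x)
      ≡⟨ ∑-cong (p * n) (λ x → ∑-cong p (λ u → cong (sqCount k a (p * n) (p * n)) (swap d _ _))) ⟩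
    ∑[ x < p * n ] ∑[ u < p ] sqCount k a (p * n) (p * n) ((d ℤ.+ a ·² x) ℤ.+ + (n * b * u))
      ≡⟨ ∑-cong (p * n) (λ x → ∑-sqCount-lift p∤b k a n (d ℤ.+ a ·² x)) ⟩
    ∑[ x < p * n ] (p ^ k * sqCount k a n n (d ℤ.+ a ·² x))
      ≡⟨ ∑-distribˡ-* (p * n) (p ^ k) _ ⟩
    p ^ k * ∑[ x < p * n ] sqCount k a n n (d ℤ.+ a ·² x)
      ≡⟨ cong (p ^ k *_) (∑-sqCount-periodic k a n n p d) ⟩
    p ^ k * (p * sqCount (suc k) a n n d)
      ≡⟨ ^-*-suc p k _ ⟩
    p ^ suc k * sqCount (suc k) a n n d
      ∎
    where
    swap : ∀ d s t → (d ℤ.+ s) ℤ.+ t ≡ (d ℤ.+ t) ℤ.+ s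
    swap = ℤ-Ring.solve-∀

-- Primitive and imprimitive solutions

if-∣ : ∀ {d x} (u v : ℕ) → d ℕ.∣ x → (if does (d ℕ.∣? x) then u else v) ≡ u
if-∣ u v d∣x = cong (if_then u else v) (dec-true (_ ℕ.∣? _) d∣x)

if-∤ : ∀ {d x} (u v : ℕ) → ¬ d ℕ.∣ x → (if does (d ℕ.∣? x) then u else v) ≡ v
if-∤ u v d∤x = cong (if_then u else v) (dec-false (_ ℕ.∣? _) d∤x)

module _ (p : ℕ) where

  -- Of the solutions counted by sqCount k 1 N N c, primCount counts those with some coordinate
  -- not divisible by p and impCount those with all coordinates divisible by p.
  primCount : ℕ → ℕ → ℤ → ℕ
  primCount zero    N c = 0
  primCount (suc k) N c = ∑[ x < N ]
    (if does (p ℕ.∣? x) then primCount k N (c ℤ.+ 1 ·² x) else sqCount k 1 N N (c ℤ.+ 1 ·² x))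

  impCount : ℕ → ℕ → ℤ → ℕ
  impCount zero    N c = 𝟙[ N ∣ c ]
  impCount (suc k) N c = ∑[ x < N ] (if does (p ℕ.∣? x) then impCount k N (c ℤ.+ 1 ·² x) else 0)

  sqCount≡prim+imp : ∀ k N c → sqCount k 1 N N c ≡ primCount k N c + impCount k N c
  sqCount≡prim+imp zero    N c = refl
  sqCount≡prim+imp (suc k) N c = trans (∑-cong N split) (∑-distrib-+ N _ _)
    where
    split : ∀ x → sqCount k 1 N N (c ℤ.+ 1 ·² x)
      ≡ (if does (p ℕ.∣? x) then primCount k N (c ℤ.+ 1 ·² x) else sqCount k 1 N N (c ℤ.+ 1 ·² x))
      + (if does (p ℕ.∣? x) then impCount k N (c ℤ.+ 1 ·² x) else 0)
    split x with p ℕ.∣? x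
    ... | yes _ = sqCount≡prim+imp k N (c ℤ.+ 1 ·² x)
    ... | no  _ = sym (ℕ.+-identityʳ _)

  primCount-mod : ∀ k {N c c′} → c ≡ c′ mod N → primCount k N c ≡ primCount k N c′
  primCount-mod zero    c≡c′ = refl
  primCount-mod (suc k) {N} c≡c′ = ∑-cong N λ x → cong₂ (if does (p ℕ.∣? x) then_else_)
    (primCount-mod k (≡-mod-+ʳ (1 ·² x) c≡c′)) (sqCount-mod k (≡-mod-+ʳ (1 ·² x) c≡c′))

  ∤-residue : ∀ z {r} → r < p → r ≢ 0 → ¬ p ℕ.∣ z * p + r
  ∤-residue z {zero}  _   r≢0 _ = r≢0 refl
  ∤-residue z {suc r} r<p _   p∣zp+r = contradiction (ℕ.∣m+n∣m⇒∣n p∣zp+r (ℕ.n∣m*n z)) (ℕ.>⇒∤ r<p)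

  impCount≡sqCount : .{{_ : NonZero p}} → ∀ k M c → impCount k (p * M) c ≡ sqCount k (p * p) M (p * M) c
  impCount≡sqCount zero    M c = refl
  impCount≡sqCount (suc k) M c = begin
    ∑< (p * M) g                              ≡⟨ cong (λ N → ∑< N g) (ℕ.*-comm p M) ⟩
    ∑< (M * p) g                              ≡⟨ ∑-blocks M p g ⟩
    ∑[ z < M ] ∑[ r < p ] g (z * p + r)       ≡⟨ ∑-cong M multiple-of-p ⟩
    ∑[ z < M ] sqCount k (p * p) M (p * M) (c ℤ.+ (p * p) ·² z) ∎
    where
    g : ℕ → ℕ
    g x = if does (p ℕ.∣? x) then impCount k (p * M) (c ℤ.+ 1 ·² x) else 0
    square : ∀ z p → 1 * ((z * p + 0) * (z * p + 0)) ≡ p * p * (z * z)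
    square = ℕ-Ring.solve-∀
    multiple-of-p : ∀ z → ∑[ r < p ] g (z * p + r) ≡ sqCount k (p * p) M (p * M) (c ℤ.+ (p * p) ·² z)
    multiple-of-p z = begin
      ∑[ r < p ] g (z * p + r)     ≡⟨ ∑-single p _ 0 (>-nonZero⁻¹ p)
                                       (λ r r<p r≢0 → if-∤ _ 0 (∤-residue z r<p r≢0)) ⟩
      g (z * p + 0)                ≡⟨ if-∣ {p} _ 0 (ℕ.∣-trans (ℕ.n∣m*n z) (ℕ.∣-reflexive (sym (ℕ.+-identityʳ _)))) ⟩
      impCount k (p * M) (c ℤ.+ 1 ·² (z * p + 0))        ≡⟨ cong (λ t → impCount k (p * M) (c ℤ.+ + t)) (square z p) ⟩
      impCount k (p * M) (c ℤ.+ (p * p) ·² z)           ≡⟨ impCount≡sqCount k M _ ⟩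
      sqCount k (p * p) M (p * M) (c ℤ.+ (p * p) ·² z) ∎

hensel-square : ∀ {p M} → p ℕ.∣ M → ∀ c z y →
  c ℤ.+ 1 ·² (z * M + y) ≡ (c ℤ.+ 1 ·² y) ℤ.+ + (M * (2 * y) * z) mod p * M
hensel-square {p} (ℕ.divides m refl) c z y =
  subst (λ t → c ℤ.+ 1 ·² (z * (m * p) + y) ≡ t mod p * (m * p)) (regroup (1 * (y * y)) (m * p * (2 * y) * z))
        (≡-mod-+ˡ c (ℕ-≡-mod (m * (z * z)) (expand m p z y)))
  where
  expand : ∀ m p z y → 1 * ((z * (m * p) + y) * (z * (m * p) + y))
         ≡ (1 * (y * y) + m * p * (2 * y) * z) + m * (z * z) * (p * (m * p))
  expand = ℕ-Ring.solve-∀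
  regroup : ∀ s t → c ℤ.+ + (s + t) ≡ (c ℤ.+ + s) ℤ.+ + t
  regroup s t = trans (cong (ℤ._+_ c) (ℤ.pos-+ s t)) (sym (ℤ.+-assoc c (+ s) (+ t)))

-- Reduction along the valuation of λ

∣-neg⇒∣ : ∀ {d m} → + d ∣ᶻ - + m → d ℕ.∣ m
∣-neg⇒∣ {d} {m} d∣-m = subst (d ℕ.∣_) (ℤ.∣-i∣≡∣i∣ (+ m)) (ℤ∣.∣⇒∣ᵤ d∣-m)

∣⇒∣-neg : ∀ {d m} → d ℕ.∣ m → + d ∣ᶻ - + m
∣⇒∣-neg = ℤ∣.∣m⇒∣-m ∘ ℤ∣.∣ᵤ⇒∣

Ω-term-shift : ∀ k p s i → p ^ (k * suc i + (s ∸ 2 * suc i ∸ 1) * (k ∸ 1))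
                          ≡ p ^ k * p ^ (k * i + (s ∸ 2 ∸ 2 * i ∸ 1) * (k ∸ 1))
Ω-term-shift k p s i = trans (cong (p ^_) exponent) (ℕ.^-distribˡ-+-* p k _)
  where
  exponent : k * suc i + (s ∸ 2 * suc i ∸ 1) * (k ∸ 1) ≡ k + (k * i + (s ∸ 2 ∸ 2 * i ∸ 1) * (k ∸ 1))
  exponent = begin
    k * suc i + (s ∸ 2 * suc i ∸ 1) * (k ∸ 1)       ≡⟨ cong₂ (λ a b → a + (s ∸ b ∸ 1) * (k ∸ 1)) (ℕ.*-suc k i) (ℕ.*-suc 2 i) ⟩
    (k + k * i) + (s ∸ (2 + 2 * i) ∸ 1) * (k ∸ 1)   ≡⟨ cong (λ a → (k + k * i) + (a ∸ 1) * (k ∸ 1)) (ℕ.∸-+-assoc s 2 (2 * i)) ⟨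
    (k + k * i) + (s ∸ 2 ∸ 2 * i ∸ 1) * (k ∸ 1)     ≡⟨ ℕ.+-assoc k (k * i) _ ⟩
    k + (k * i + (s ∸ 2 ∸ 2 * i ∸ 1) * (k ∸ 1))     ∎

Ω-suc : ∀ k p s m → Ω k p s (suc m) ≡ p ^ ((s ∸ 1) * (k ∸ 1)) + p ^ k * Ω k p (s ∸ 2) m
Ω-suc k p s zero = begin
  0 + p ^ (k * 0 + (s ∸ 1) * (k ∸ 1))     ≡⟨ cong (λ a → p ^ (a + (s ∸ 1) * (k ∸ 1))) (ℕ.*-zeroʳ k) ⟩
  p ^ ((s ∸ 1) * (k ∸ 1))                 ≡⟨ ℕ.+-identityʳ _ ⟨
  p ^ ((s ∸ 1) * (k ∸ 1)) + 0             ≡⟨ cong (_+_ (p ^ ((s ∸ 1) * (k ∸ 1)))) (ℕ.*-zeroʳ (p ^ k)) ⟨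
  p ^ ((s ∸ 1) * (k ∸ 1)) + p ^ k * 0     ∎
Ω-suc k p s (suc m) = begin
  Ω k p s (suc m) + p ^ (k * suc m + (s ∸ 2 * suc m ∸ 1) * (k ∸ 1))  ≡⟨ cong₂ _+_ (Ω-suc k p s m) (Ω-term-shift k p s m) ⟩
  (a + p ^ k * Ω k p (s ∸ 2) m) + p ^ k * T                          ≡⟨ ℕ.+-assoc a _ _ ⟩
  a + (p ^ k * Ω k p (s ∸ 2) m + p ^ k * T)                          ≡⟨ cong (_+_ a) (ℕ.*-distribˡ-+ (p ^ k) _ T) ⟨
  a + p ^ k * (Ω k p (s ∸ 2) m + T)                                  ∎
  where
  a = p ^ ((s ∸ 1) * (k ∸ 1))
  T = p ^ (k * m + (s ∸ 2 ∸ 2 * m ∸ 1) * (k ∸ 1))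

module _ {p : ℕ} (p-prime : Prime p) (p≢2 : p ≢ 2) where

  private instance
    p≢0 : NonZero p
    p≢0 = prime⇒nonZero p-prime

  ∤-double : ∀ {y} → ¬ p ℕ.∣ y → ¬ p ℕ.∣ 2 * y
  ∤-double {y} p∤y p∣2y with euclidsLemma 2 y p-prime p∣2y
  ... | inj₁ p∣2 = p≢2 (ℕ.≤-antisym (ℕ.∣⇒≤ p∣2) (nonTrivial⇒n>1 p {{prime⇒nonTrivial p-prime}}))
  ... | inj₂ p∣y = p∤y p∣y

  -- Hensel lifting: each primitive solution modulo M has exactly p^(k-1) lifts modulo p M.
  primCount-lift : ∀ k {M} .{{_ : NonZero M}} → p ℕ.∣ M → ∀ c →
    p * primCount p k (p * M) c ≡ p ^ k * primCount p k M c
  primCount-lift zero        p∣M c = ℕ.*-zeroʳ p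
  primCount-lift (suc k) {M} p∣M c = begin
    p * ∑< (p * M) g                               ≡⟨ cong (p *_) (∑-blocks p M g) ⟩
    p * ∑[ z < p ] ∑[ y < M ] g (z * M + y)        ≡⟨ cong (p *_) (∑-comm p M _) ⟩
    p * ∑[ y < M ] ∑[ z < p ] g (z * M + y)        ≡⟨ ∑-distribˡ-* M p _ ⟨
    ∑[ y < M ] (p * ∑[ z < p ] g (z * M + y))      ≡⟨ ∑-cong M (λ y → [ column-∣ y , column-∤ y ]′ (toSum (p ℕ.∣? y))) ⟩
    ∑[ y < M ] (p ^ suc k * h y)                   ≡⟨ ∑-distribˡ-* M (p ^ suc k) h ⟩
    p ^ suc k * primCount p (suc k) M c            ∎
    where
    g h : ℕ → ℕ
    g x = if does (p ℕ.∣? x) then primCount p k (p * M) (c ℤ.+ 1 ·² x) else sqCount k 1 (p * M) (p * M) (c ℤ.+ 1 ·² x)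
    h y = if does (p ℕ.∣? y) then primCount p k M (c ℤ.+ 1 ·² y) else sqCount k 1 M M (c ℤ.+ 1 ·² y)
    p∣zM : ∀ z → p ℕ.∣ z * M
    p∣zM z = ℕ.∣-trans p∣M (ℕ.n∣m*n z)
    column-∣ : ∀ y → p ℕ.∣ y → p * ∑[ z < p ] g (z * M + y) ≡ p ^ suc k * h y
    column-∣ y p∣y = begin
      p * ∑[ z < p ] g (z * M + y)                                   ≡⟨ cong (p *_) (∑-cong p λ z →
                                                                          if-∣ _ _ (ℕ.∣m∣n⇒∣m+n (p∣zM z) p∣y)) ⟩
      p * ∑[ z < p ] primCount p k (p * M) (c ℤ.+ 1 ·² (z * M + y))   ≡⟨ ∑-distribˡ-* p p _ ⟨
      ∑[ z < p ] (p * primCount p k (p * M) (c ℤ.+ 1 ·² (z * M + y))) ≡⟨ ∑-cong p (λ z →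
        trans (primCount-lift k p∣M _) (cong (p ^ k *_) (primCount-mod p k (≡-mod-+ˡ c (square-periodic 1 M z y))))) ⟩
      ∑[ z < p ] (p ^ k * primCount p k M (c ℤ.+ 1 ·² y))             ≡⟨ ∑-const p _ ⟩
      p * (p ^ k * primCount p k M (c ℤ.+ 1 ·² y))                   ≡⟨ ℕ.*-assoc p (p ^ k) _ ⟨
      p ^ suc k * primCount p k M (c ℤ.+ 1 ·² y)                     ≡⟨ cong (p ^ suc k *_) (if-∣ _ _ p∣y) ⟨
      p ^ suc k * h y                                                ∎
    column-∤ : ∀ y → ¬ p ℕ.∣ y → p * ∑[ z < p ] g (z * M + y) ≡ p ^ suc k * h y
    column-∤ y p∤y = begin
      p * ∑[ z < p ] g (z * M + y)                                   ≡⟨ cong (p *_) (∑-cong p λ z →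
        trans (if-∤ _ _ (p∤y ∘ flip ℕ.∣m+n∣m⇒∣n (p∣zM z))) (sqCount-mod k (hensel-square p∣M c z y))) ⟩
      p * ∑[ z < p ] sqCount k 1 (p * M) (p * M) ((c ℤ.+ 1 ·² y) ℤ.+ + (M * (2 * y) * z))
                                                                     ≡⟨ cong (p *_) (∑-sqCount-lift p-prime (∤-double p∤y) k 1 M _) ⟩
      p * (p ^ k * sqCount k 1 M M (c ℤ.+ 1 ·² y))                   ≡⟨ ℕ.*-assoc p (p ^ k) _ ⟨
      p ^ suc k * sqCount k 1 M M (c ℤ.+ 1 ·² y)                     ≡⟨ cong (p ^ suc k *_) (if-∤ _ _ p∤y) ⟨
      p ^ suc k * h y                                                ∎

  primCount-pow : ∀ k j c → primCount p (suc k) (p ^ suc j) c ≡ p ^ (j * k) * primCount p (suc k) p c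
  primCount-pow k zero    c = trans (cong (λ N → primCount p (suc k) N c) (ℕ.*-identityʳ p)) (sym (ℕ.*-identityˡ _))
  primCount-pow k (suc j) c = begin
    primCount p (suc k) (p ^ suc (suc j)) c          ≡⟨ ℕ.*-cancelˡ-≡ _ _ p lift ⟩
    p ^ k * primCount p (suc k) (p ^ suc j) c        ≡⟨ cong (p ^ k *_) (primCount-pow k j c) ⟩
    p ^ k * (p ^ (j * k) * primCount p (suc k) p c)  ≡⟨ ℕ.*-assoc (p ^ k) _ _ ⟨
    p ^ k * p ^ (j * k) * primCount p (suc k) p c    ≡⟨ cong (_* primCount p (suc k) p c) (ℕ.^-distribˡ-+-* p k (j * k)) ⟨
    p ^ (suc j * k) * primCount p (suc k) p c        ∎
    where
    lift : p * primCount p (suc k) (p * p ^ suc j) c ≡ p * (p ^ k * primCount p (suc k) (p ^ suc j) c)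
    lift = trans (primCount-lift (suc k) {{ℕ.m^n≢0 p (suc j)}} (ℕ.m∣m*n (p ^ j)) c)
                 (ℕ.*-assoc p (p ^ k) _)

  ρ-decomposition : ∀ k s lam → ρ (suc k) (+ lam) (p ^ suc s)
    ≡ p ^ (s * k) * primCount p (suc k) p (- + lam) + sqCount (suc k) (p * p) (p ^ s) (p ^ suc s) (- + lam)
  ρ-decomposition k s lam = begin
    ρ (suc k) (+ lam) (p ^ suc s)                                       ≡⟨ ρ≡sqCount (suc k) (+ lam) (p ^ suc s) ⟩
    sqCount (suc k) 1 (p ^ suc s) (p ^ suc s) (- + lam)                  ≡⟨ sqCount≡prim+imp p (suc k) (p ^ suc s) (- + lam) ⟩
    primCount p (suc k) (p ^ suc s) (- + lam) + impCount p (suc k) (p ^ suc s) (- + lam)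
                                                                        ≡⟨ cong₂ _+_ (primCount-pow k s (- + lam)) (impCount≡sqCount p (suc k) (p ^ s) (- + lam)) ⟩
    p ^ (s * k) * primCount p (suc k) p (- + lam) + sqCount (suc k) (p * p) (p ^ s) (p ^ suc s) (- + lam) ∎

  impCount-p : ∀ k c → impCount p k p c ≡ 𝟙[ p ∣ c ]
  impCount-p k c = subst (λ N → impCount p k N c ≡ 𝟙[ N ∣ c ]) (ℕ.*-identityʳ p)
                         (trans (impCount≡sqCount p k 1 c) (sqCount-range-1 k (p * p) (p * 1) c))

  primCount-p-coprime : ∀ k m → ¬ p ℕ.∣ m → primCount p k p (- + m) ≡ ρ k (+ m) p
  primCount-p-coprime k m p∤m = begin
    primCount p k p (- + m)                              ≡⟨ ℕ.+-identityʳ _ ⟨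
    primCount p k p (- + m) + 0                          ≡⟨ cong (_+_ (primCount p k p (- + m))) (trans (impCount-p k _) (𝟙-no (p∤m ∘ ∣-neg⇒∣))) ⟨
    primCount p k p (- + m) + impCount p k p (- + m)     ≡⟨ sqCount≡prim+imp p k p _ ⟨
    sqCount k 1 p p (- + m)                              ≡⟨ ρ≡sqCount k (+ m) p ⟨
    ρ k (+ m) p                                          ∎

  primCount-p-multiple : ∀ k c → + p ∣ᶻ c → primCount p k p c ≡ ρ k (+ 0) p ∸ 1
  primCount-p-multiple k c p∣c = begin
    primCount p k p c                                    ≡⟨ ℕ.m+n∸n≡m _ 1 ⟨
    primCount p k p c + 1 ∸ 1                            ≡⟨ cong (λ i → primCount p k p c + i ∸ 1) (trans (impCount-p k c) (𝟙-yes p∣c)) ⟨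
    primCount p k p c + impCount p k p c ∸ 1             ≡⟨ cong (_∸ 1) (sqCount≡prim+imp p k p c) ⟨
    sqCount k 1 p p c ∸ 1                                ≡⟨ cong (_∸ 1) (sqCount-mod k (mod-by (subst (_ ∣ᶻ_) (sym (ℤ.+-identityʳ c)) p∣c))) ⟩
    sqCount k 1 p p (+ 0) ∸ 1                            ≡⟨ cong (_∸ 1) (ρ≡sqCount k (+ 0) p) ⟨
    ρ k (+ 0) p ∸ 1                                      ∎

  sqCount-p²-multiple : ∀ k s m →
    sqCount k (p * p) (p ^ suc s) (p ^ suc (suc s)) (- + (p * p * m)) ≡ p ^ k * ρ k (+ m) (p ^ s)
  sqCount-p²-multiple k s m = begin
    sqCount k (p * p) (p ^ suc s) (p * (p * p ^ s)) (- + (p * p * m))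
      ≡⟨ cong₂ (sqCount k (p * p) (p ^ suc s)) (ℕ.*-assoc p p (p ^ s)) (sym -pp·m≡pp·-m) ⟨
    sqCount k (p * p) (p ^ suc s) (p * p * p ^ s) (+ (p * p) ℤ.* - + m)
      ≡⟨ cong (λ a → sqCount k a (p ^ suc s) (p * p * p ^ s) (+ (p * p) ℤ.* - + m)) (ℕ.*-identityʳ (p * p)) ⟨
    sqCount k (p * p * 1) (p ^ suc s) (p * p * p ^ s) (+ (p * p) ℤ.* - + m)
      ≡⟨ sqCount-scale k (p * p) {{ℕ.m*n≢0 p p}} 1 (p ^ suc s) (p ^ s) (- + m) ⟩
    sqCount k 1 (p * p ^ s) (p ^ s) (- + m)
      ≡⟨ sqCount-range k 1 (p ^ s) p (- + m) ⟩
    p ^ k * sqCount k 1 (p ^ s) (p ^ s) (- + m)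
      ≡⟨ cong (p ^ k *_) (ρ≡sqCount k (+ m) (p ^ s)) ⟨
    p ^ k * ρ k (+ m) (p ^ s)
      ∎
    where
    -pp·m≡pp·-m : - + (p * p * m) ≡ + (p * p) ℤ.* - + m
    -pp·m≡pp·-m = trans (cong -_ (ℤ.pos-* (p * p) m)) (ℤ.neg-distribʳ-* (+ (p * p)) (+ m))

  ρ-coprime : ∀ k s m → ¬ p ℕ.∣ m → ρ (suc k) (+ m) (p ^ suc s) ≡ p ^ (s * k) * ρ (suc k) (+ m) p
  ρ-coprime k s m p∤m = begin
    ρ (suc k) (+ m) (p ^ suc s)
      ≡⟨ ρ-decomposition k s m ⟩
    p ^ (s * k) * primCount p (suc k) p (- + m) + sqCount (suc k) (p * p) (p ^ s) (p ^ suc s) (- + m)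
      ≡⟨ cong₂ _+_ (cong (p ^ (s * k) *_) (primCount-p-coprime (suc k) m p∤m))
                   (sqCount-vanish (suc k) {R = p ^ s} (ℕ.m∣m*n p) (ℕ.m∣m*n (p ^ s)) (p∤m ∘ ∣-neg⇒∣)) ⟩
    p ^ (s * k) * ρ (suc k) (+ m) p + 0
      ≡⟨ ℕ.+-identityʳ _ ⟩
    p ^ (s * k) * ρ (suc k) (+ m) p
      ∎

  ρ-p·coprime : ∀ k s m → ¬ p ℕ.∣ m →
    ρ (suc k) (+ (p * m)) (p ^ suc (suc s)) ≡ p ^ (suc s * k) * (ρ (suc k) (+ 0) p ∸ 1)
  ρ-p·coprime k s m p∤m = begin
    ρ (suc k) (+ (p * m)) (p ^ suc (suc s))
      ≡⟨ ρ-decomposition k (suc s) (p * m) ⟩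
    p ^ (suc s * k) * primCount p (suc k) p (- + (p * m))
      + sqCount (suc k) (p * p) (p ^ suc s) (p ^ suc (suc s)) (- + (p * m))
      ≡⟨ cong₂ _+_ (cong (p ^ (suc s * k) *_) (primCount-p-multiple (suc k) _ (∣⇒∣-neg (ℕ.m∣m*n m))))
                   (sqCount-vanish (suc k) {R = p ^ suc s} ℕ.∣-refl pp∣p^[2+s] (p∤m ∘ ℕ.*-cancelˡ-∣ p ∘ ∣-neg⇒∣)) ⟩
    p ^ (suc s * k) * (ρ (suc k) (+ 0) p ∸ 1) + 0
      ≡⟨ ℕ.+-identityʳ _ ⟩
    p ^ (suc s * k) * (ρ (suc k) (+ 0) p ∸ 1)
      ∎
    where
    pp∣p^[2+s] : p * p ℕ.∣ p ^ suc (suc s)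
    pp∣p^[2+s] = ℕ.∣-trans (ℕ.m∣m*n (p ^ s)) (ℕ.∣-reflexive (ℕ.*-assoc p p (p ^ s)))

  ρ-p²· : ∀ k s m → ρ (suc k) (+ (p * p * m)) (p ^ suc (suc s))
    ≡ p ^ (suc s * k) * (ρ (suc k) (+ 0) p ∸ 1) + p ^ suc k * ρ (suc k) (+ m) (p ^ s)
  ρ-p²· k s m = trans (ρ-decomposition k (suc s) (p * p * m))
    (cong₂ _+_ (cong (p ^ (suc s * k) *_) (primCount-p-multiple (suc k) _ (∣⇒∣-neg (ℕ.∣-trans (ℕ.m∣m*n p) (ℕ.m∣m*n m)))))
               (sqCount-p²-multiple (suc k) s m))

  p^[2+e]*m : ∀ e m → p ^ (2 + e) * m ≡ p * p * (p ^ e * m)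
  p^[2+e]*m e m = regroup p (p ^ e) m
    where
    regroup : ∀ p q m → p * (p * q) * m ≡ p * p * (q * m)
    regroup = ℕ-Ring.solve-∀

  ρ-odd-valuation : ∀ k t s m → ¬ p ℕ.∣ m → 2 * t + 1 < s →
    ρ (suc k) (+ (p ^ (2 * t + 1) * m)) (p ^ s) ≡ Ω (suc k) p s (suc t) * (ρ (suc k) (+ 0) p ∸ 1)
  ρ-odd-valuation k zero    1 m _ (s≤s ())
  ρ-odd-valuation k (suc t) 1 m _ (s≤s ())
  ρ-odd-valuation k zero (suc (suc s)) m p∤m _ = begin
    ρ (suc k) (+ (p ^ 1 * m)) (p ^ suc (suc s))   ≡⟨ cong (λ q → ρ (suc k) (+ (q * m)) (p ^ suc (suc s))) (ℕ.*-identityʳ p) ⟩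
    ρ (suc k) (+ (p * m)) (p ^ suc (suc s))       ≡⟨ ρ-p·coprime k s m p∤m ⟩
    p ^ (suc s * k) * X                           ≡⟨ cong (λ e → p ^ (e + suc s * k) * X) (ℕ.*-zeroʳ k) ⟨
    Ω (suc k) p (suc (suc s)) 1 * X               ∎
    where
    X = ρ (suc k) (+ 0) p ∸ 1
  ρ-odd-valuation k (suc t) (suc (suc s)) m p∤m 2t+3<s+2 = begin
    ρ (suc k) (+ (p ^ (2 * suc t + 1) * m)) (p ^ suc (suc s))
      ≡⟨ cong (λ e → ρ (suc k) (+ (p ^ (e + 1) * m)) (p ^ suc (suc s))) (ℕ.*-suc 2 t) ⟩
    ρ (suc k) (+ (p ^ (2 + (2 * t + 1)) * m)) (p ^ suc (suc s))
      ≡⟨ cong (λ n → ρ (suc k) (+ n) (p ^ suc (suc s))) (p^[2+e]*m (2 * t + 1) m) ⟩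
    ρ (suc k) (+ (p * p * (p ^ (2 * t + 1) * m))) (p ^ suc (suc s))
      ≡⟨ ρ-p²· k s _ ⟩
    a * X + p ^ suc k * ρ (suc k) (+ (p ^ (2 * t + 1) * m)) (p ^ s)
      ≡⟨ cong (λ n → a * X + p ^ suc k * n) (ρ-odd-valuation k t s m p∤m 2t+1<s) ⟩
    a * X + p ^ suc k * (Ω (suc k) p s (suc t) * X)
      ≡⟨ factor a (p ^ suc k) (Ω (suc k) p s (suc t)) X ⟩
    (a + p ^ suc k * Ω (suc k) p s (suc t)) * X
      ≡⟨ cong (_* X) (Ω-suc (suc k) p (suc (suc s)) (suc t)) ⟨
    Ω (suc k) p (suc (suc s)) (suc (suc t)) * X
      ∎
    where
    X = ρ (suc k) (+ 0) p ∸ 1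
    a = p ^ (suc s * k)
    2t+1<s : 2 * t + 1 < s
    2t+1<s = ℕ.+-cancelˡ-< 2 _ _ (subst (λ e → e + 1 < 2 + s) (ℕ.*-suc 2 t) 2t+3<s+2)
    factor : ∀ a b c x → a * x + b * (c * x) ≡ (a + b * c) * x
    factor = ℕ-Ring.solve-∀

  ρ-even-valuation : ∀ k t s m → ¬ p ℕ.∣ m → 2 * t < s →
    ρ (suc k) (+ (p ^ (2 * t) * m)) (p ^ s)
      ≡ Ω (suc k) p s t * (ρ (suc k) (+ 0) p ∸ 1) + p ^ (suc k * t + (s ∸ 2 * t ∸ 1) * k) * ρ (suc k) (+ m) p
  ρ-even-valuation k zero (suc s) m p∤m _ = begin
    ρ (suc k) (+ (1 * m)) (p ^ suc s)             ≡⟨ cong (λ n → ρ (suc k) (+ n) (p ^ suc s)) (ℕ.*-identityˡ m) ⟩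
    ρ (suc k) (+ m) (p ^ suc s)                   ≡⟨ ρ-coprime k s m p∤m ⟩
    p ^ (s * k) * ρ (suc k) (+ m) p               ≡⟨ cong (λ e → p ^ (e + s * k) * ρ (suc k) (+ m) p) (ℕ.*-zeroʳ k) ⟨
    p ^ (suc k * 0 + s * k) * ρ (suc k) (+ m) p   ∎
  ρ-even-valuation k (suc t) 1 m _ (s≤s ())
  ρ-even-valuation k (suc t) (suc (suc s)) m p∤m 2t+2<s+2 = begin
    ρ (suc k) (+ (p ^ (2 * suc t) * m)) (p ^ suc (suc s))
      ≡⟨ cong (λ e → ρ (suc k) (+ (p ^ e * m)) (p ^ suc (suc s))) (ℕ.*-suc 2 t) ⟩
    ρ (suc k) (+ (p ^ (2 + 2 * t) * m)) (p ^ suc (suc s))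
      ≡⟨ cong (λ n → ρ (suc k) (+ n) (p ^ suc (suc s))) (p^[2+e]*m (2 * t) m) ⟩
    ρ (suc k) (+ (p * p * (p ^ (2 * t) * m))) (p ^ suc (suc s))
      ≡⟨ ρ-p²· k s _ ⟩
    a * X + p ^ suc k * ρ (suc k) (+ (p ^ (2 * t) * m)) (p ^ s)
      ≡⟨ cong (λ n → a * X + p ^ suc k * n) (ρ-even-valuation k t s m p∤m 2t<s) ⟩
    a * X + p ^ suc k * (Ω (suc k) p s t * X + p ^ e * Y)
      ≡⟨ factor a (p ^ suc k) (Ω (suc k) p s t) X (p ^ e) Y ⟩
    (a + p ^ suc k * Ω (suc k) p s t) * X + p ^ suc k * p ^ e * Y
      ≡⟨ cong₂ (λ u v → u * X + v * Y) (Ω-suc (suc k) p (suc (suc s)) t) (Ω-term-shift (suc k) p (suc (suc s)) t) ⟨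
    Ω (suc k) p (suc (suc s)) (suc t) * X + p ^ (suc k * suc t + (suc (suc s) ∸ 2 * suc t ∸ 1) * k) * Y
      ∎
    where
    X = ρ (suc k) (+ 0) p ∸ 1
    Y = ρ (suc k) (+ m) p
    a = p ^ (suc s * k)
    e = suc k * t + (s ∸ 2 * t ∸ 1) * k
    2t<s : 2 * t < s
    2t<s = ℕ.+-cancelˡ-< 2 _ _ (subst (_< 2 + s) (ℕ.*-suc 2 t) 2t+2<s+2)
    factor : ∀ a b c x d y → a * x + b * (c * x + d * y) ≡ (a + b * c) * x + b * d * y
    factor = ℕ-Ring.solve-∀

corollary1 : (p s k lam r lam′ : ℕ) → Prime p → p ≢ 2 → 1 ≤ s → 1 ≤ k
    → 0 < lam → lam < p ^ s → lam ≡ p ^ r * lam′ → r < s → ¬ (p ∣ lam′)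
    → ((t : ℕ) → r ≡ 2 * t + 1
         → ρ k (+ lam) (p ^ s) ≡ Ω k p s (t + 1) * (ρ k (+ 0) p ∸ 1))
      × ((t : ℕ) → r ≡ 2 * t
         → ρ k (+ lam) (p ^ s)
             ≡ Ω k p s t * (ρ k (+ 0) p ∸ 1)
               + p ^ (k * t + (s ∸ r ∸ 1) * (k ∸ 1)) * ρ k (+ lam′) p)
corollary1 p s zero    lam r lam′ _       _   _ () _ _ _ _ _
corollary1 p s (suc k) lam r lam′ p-prime p≢2 _ _ _ _ lam≡p^r·lam′ r<s p∤lam′ = odd , even
  where
  X = ρ (suc k) (+ 0) p ∸ 1
  ρ-lam : ∀ {e} → r ≡ e → ρ (suc k) (+ lam) (p ^ s) ≡ ρ (suc k) (+ (p ^ e * lam′)) (p ^ s)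
  ρ-lam r≡e = cong (λ n → ρ (suc k) (+ n) (p ^ s)) (trans lam≡p^r·lam′ (cong (λ e → p ^ e * lam′) r≡e))
  odd : (t : ℕ) → r ≡ 2 * t + 1 → ρ (suc k) (+ lam) (p ^ s) ≡ Ω (suc k) p s (t + 1) * X
  odd t r≡2t+1 = begin
    ρ (suc k) (+ lam) (p ^ s)                       ≡⟨ ρ-lam r≡2t+1 ⟩
    ρ (suc k) (+ (p ^ (2 * t + 1) * lam′)) (p ^ s)  ≡⟨ ρ-odd-valuation p-prime p≢2 k t s lam′ p∤lam′ (subst (_< s) r≡2t+1 r<s) ⟩
    Ω (suc k) p s (suc t) * X                       ≡⟨ cong (λ i → Ω (suc k) p s i * X) (ℕ.+-comm 1 t) ⟩
    Ω (suc k) p s (t + 1) * X                       ∎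
  even : (t : ℕ) → r ≡ 2 * t → ρ (suc k) (+ lam) (p ^ s)
    ≡ Ω (suc k) p s t * X + p ^ (suc k * t + (s ∸ r ∸ 1) * k) * ρ (suc k) (+ lam′) p
  even t r≡2t = begin
    ρ (suc k) (+ lam) (p ^ s)                       ≡⟨ ρ-lam r≡2t ⟩
    ρ (suc k) (+ (p ^ (2 * t) * lam′)) (p ^ s)      ≡⟨ ρ-even-valuation p-prime p≢2 k t s lam′ p∤lam′ (subst (_< s) r≡2t r<s) ⟩
    Ω (suc k) p s t * X + p ^ (suc k * t + (s ∸ 2 * t ∸ 1) * k) * ρ (suc k) (+ lam′) p
      ≡⟨ cong (λ e → Ω (suc k) p s t * X + p ^ (suc k * t + (s ∸ e ∸ 1) * k) * ρ (suc k) (+ lam′) p) r≡2t ⟨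
    Ω (suc k) p s t * X + p ^ (suc k * t + (s ∸ r ∸ 1) * k) * ρ (suc k) (+ lam′) p ∎
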